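{- Let $K$ be a commutative ring with unity, $v,w:\mathbb Z\to K$, $\alpha,\beta\in\mathbb Z$, $s\in\mathbb N=\{0,1,2,\ldots\}$, and $r\ge 0$ an integer. With the $\mathcal V$-Stirling numbers as defined in the context, and all matrices below of size $(r+1)\times(r+1)$ with row index $i$ and column index $j$ ranging over $0\le i,j\le r$, we have the matrix identities $$\Big(c^{\mathcal V}_{\alpha-i,\beta-j}[s+i+j,s+j]\Big)=\Big(c^{\mathcal V}_{\alpha-i,\beta}[s+i,s+j]\Big)\Big(c^{\mathcal V}_{\alpha+s,\beta-j}[j,j-i]\Big),$$ $$\Big(S^{\mathcal V}_{\alpha,\beta-j}[s+i+j,s+j]\Big)=\Big(S^{\mathcal V}_{\alpha,\beta-j}[s+i,s+j]\Big)\Big(S^{\mathcal V}_{\alpha+s+i,\beta-j}[j,j-i]\Big).$$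
   Context: Let $K$ be a commutative ring with unity and $v,w:\mathbb Z\to K$ functions; write $v_i=v(i)$, $w_i=w(i)$ and $\mathcal V=(v,w)$. For finitely many variables, $e_t$ denotes the $t$-th elementary symmetric function and $h_t$ the $t$-th complete homogeneous symmetric function, with $e_0=h_0=1$ and $e_t=h_t=0$ for $t<0$ (and $e_t=0$ when $t$ exceeds the number of variables). For $\alpha,\beta\in\mathbb Z$ and integers $n,k\ge 0$ define $$c^{\mathcal V}_{\alpha,\beta}[n,k]=e_{n-k}\big(v_{\alpha+n-1}w_{\beta},v_{\alpha+n-2}w_{\beta+1},\ldots,v_{\alpha}w_{\beta+n-1}\big)$$ (the $n$ arguments $v_{\alpha+n-1-i}w_{\beta+i}$, $0\le i\le n-1$), and $$S^{\mathcal V}_{\alpha,\beta}[n,k]=h_{n-k}\big(v_{\alpha+k}w_{\beta},v_{\alpha+k-1}w_{\beta+1},\ldots,v_{\alpha}w_{\beta+k}\big)$$ (the $k+1$ arguments $v_{\alpha+k-i}w_{\beta+i}$, $0\le i\le k$). In particular both vanish when $k>n$. If $n<0$ or $k<0$, both are defined to be $0$. -}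

module Defs where

open import Level using (Level)
open import Algebra.Bundles using (CommutativeRing)
open import Data.Nat as ℕ using (ℕ; zero; suc; _∸_; _≤ᵇ_)
open import Data.Integer as ℤ using (ℤ; +_; -[1+_])
open import Data.List using (List; []; _∷_; map; upTo)
open import Data.Bool using (if_then_else_)

module VStirling {c ℓ : Level} (R : CommutativeRing c ℓ) where
  open CommutativeRing R hiding (zero)

  esym : ℕ → List Carrier → Carrier
  esym zero    xs       = 1#
  esym (suc t) []       = 0#
  esym (suc t) (x ∷ xs) = x * esym t xs + esym (suc t) xs

  hsym : ℕ → List Carrier → Carrier
  hsym zero    xs       = 1#
  hsym (suc t) []       = 0#
  hsym (suc t) (x ∷ xs) = x * hsym t (x ∷ xs) + hsym (suc t) xs

  cV : (v w : ℤ → Carrier) (α β : ℤ) (n k : ℤ) → Carrier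
  cV v w α β (+ n) (+ k) =
    if k ≤ᵇ n
    then esym (n ∸ k)
              (map (λ i → v (α ℤ.+ ℤ.+ n ℤ.- ℤ.+ 1 ℤ.- ℤ.+ i) * w (β ℤ.+ ℤ.+ i)) (upTo n))
    else 0#
  cV v w α β (+ n) -[1+ k ] = 0#
  cV v w α β -[1+ n ] k = 0#

  SV : (v w : ℤ → Carrier) (α β : ℤ) (n k : ℤ) → Carrier
  SV v w α β (+ n) (+ k) =
    if k ≤ᵇ n
    then hsym (n ∸ k)
              (map (λ i → v (α ℤ.+ ℤ.+ k ℤ.- ℤ.+ i) * w (β ℤ.+ ℤ.+ i)) (upTo (suc k)))
    else 0#
  SV v w α β (+ n) -[1+ k ] = 0#
  SV v w α β -[1+ n ] k = 0#

  sumTo : ℕ → (ℕ → Carrier) → Carrier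
  sumTo 0       f = f 0
  sumTo (suc r) f = sumTo r f + f (suc r)

module Submission where

-- Both identities are statements about symmetric functions of runs of the
-- "anti-diagonal" products  diag c b t = v_{c-t} w_{b+t}:  cV is an elementary
-- symmetric function e of such a run and SV a complete homogeneous one h.
--
--  * The c-identity is the product rule for e on a concatenation,
--      e_i(A ++ B) = Σ_k e_k(A) e_{i-k}(B),
--    applied to the run of length s+i+j split after its first j entries.
--  * The S-identity is the "overlapping windows" rule for h,
--      h_i(g_0..g_{j+m}) = Σ_{k≤j} h_k(g_0..g_{j-k}) h_{i-k}(g_{j-k}..g_{j+m}),
--    proved by induction on j from the recursion h_{i+1}(x∷L) = x h_i(x∷L) + h_{i+1}(L).
--
-- The summation in
-- the theorem runs to r; the products naturally stop at i (resp. j), and the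
-- remaining terms vanish.

open import Defs
open import Level using (Level)
open import Algebra.Bundles using (CommutativeRing)
open import Data.Bool using (true; false)
open import Data.Bool.Properties using (T-≡; ¬-not)
import Data.Nat  -- the statement of theorem6p2 refers to Data.Nat._+_ qualified
open import Data.Nat as ℕ using (ℕ; zero; suc; _∸_; _≤_; _<_; _≤ᵇ_; z≤n; s≤s)
open import Data.Nat.Properties as ℕP using ()
open import Algebra.Properties.CommutativeSemigroup ℕP.+-commutativeSemigroup
  using () renaming (xy∙z≈xz∙y to ℕ-+-right-comm)
open import Data.Integer as ℤ using (ℤ; +_; -[1+_])
open import Data.Integer.Properties as ℤP using ()
open import Data.Integer.Tactic.RingSolver using (solve-∀)
open import Data.List using (List; []; _∷_; _++_; applyUpTo; length)
open import Data.List.Properties using (map-upTo; length-applyUpTo)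
open import Data.Product using (_×_; _,_; Σ; proj₂)
open import Data.Sum using (inj₁; inj₂)
open import Function using (_∘_)
open import Function.Bundles using (Equivalence)
open import Relation.Nullary using (yes; no)
open import Relation.Binary.PropositionalEquality as ≡
  using (_≡_; refl; cong; cong₂)

≤ᵇ-true : ∀ {m n} → m ≤ n → (m ≤ᵇ n) ≡ true
≤ᵇ-true m≤n = Equivalence.to T-≡ (ℕP.≤⇒≤ᵇ m≤n)

≤ᵇ-false : ∀ {m n} → n < m → (m ≤ᵇ n) ≡ false
≤ᵇ-false {m} {n} n<m =
  ¬-not (λ eq → ℕP.<⇒≱ n<m (ℕP.≤ᵇ⇒≤ m n (Equivalence.from T-≡ eq)))

minus-pos : ∀ {j k} → k ≤ j → + j ℤ.- + k ≡ + (j ∸ k)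
minus-pos {j} {k} k≤j = ≡.trans (ℤP.m-n≡m⊖n j k) (ℤP.⊖-≥ k≤j)

minus-neg : ∀ {j k} → j < k → Σ ℕ (λ d → + j ℤ.- + k ≡ -[1+ d ])
minus-neg {j} {suc k} (s≤s j≤k) =
  k ∸ j , ≡.trans (ℤP.m-n≡m⊖n j (suc k))
                  (≡.trans (ℤP.⊖-< (s≤s j≤k)) (cong (ℤ.-_ ∘ +_) (ℕP.+-∸-assoc 1 j≤k)))

applyUpTo-cong : ∀ {a} {A : Set a} {f g : ℕ → A} n →
                 (∀ t → f t ≡ g t) → applyUpTo f n ≡ applyUpTo g n
applyUpTo-cong zero    f≗g = refl
applyUpTo-cong (suc n) f≗g = cong₂ _∷_ (f≗g 0) (applyUpTo-cong n (f≗g ∘ suc))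

applyUpTo-++ : ∀ {a} {A : Set a} (f : ℕ → A) m n →
               applyUpTo f (m ℕ.+ n) ≡ applyUpTo f m ++ applyUpTo (λ t → f (m ℕ.+ t)) n
applyUpTo-++ f zero    n = refl
applyUpTo-++ f (suc m) n = cong (f 0 ∷_) (applyUpTo-++ (f ∘ suc) m n)

module SymmetricFunctions {c ℓ : Level} (R : CommutativeRing c ℓ) where
  open CommutativeRing R hiding (zero) renaming (refl to ≈-refl)
  open VStirling R
  open import Algebra.Properties.CommutativeSemigroup +-commutativeSemigroup
    using (interchange; x∙yz≈y∙xz)
  open import Relation.Binary.Reasoning.Setoid setoid

  sumTo-cong : ∀ n {f g : ℕ → Carrier} → (∀ k → k ≤ n → f k ≈ g k) →
               sumTo n f ≈ sumTo n g
  sumTo-cong zero    f≈g = f≈g 0 z≤n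
  sumTo-cong (suc n) f≈g =
    +-cong (sumTo-cong n (λ k k≤n → f≈g k (ℕP.m≤n⇒m≤1+n k≤n))) (f≈g (suc n) ℕP.≤-refl)

  sumTo-head : ∀ n (f : ℕ → Carrier) → sumTo (suc n) f ≈ f 0 + sumTo n (f ∘ suc)
  sumTo-head zero    f = ≈-refl
  sumTo-head (suc n) f = trans (+-congʳ (sumTo-head n f)) (+-assoc _ _ _)

  sumTo-+ : ∀ n (f g : ℕ → Carrier) →
            sumTo n (λ k → f k + g k) ≈ sumTo n f + sumTo n g
  sumTo-+ zero    f g = ≈-refl
  sumTo-+ (suc n) f g = trans (+-congʳ (sumTo-+ n f g)) (interchange _ _ _ _)

  sumTo-*ˡ : ∀ n x (f : ℕ → Carrier) → sumTo n (λ k → x * f k) ≈ x * sumTo n f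
  sumTo-*ˡ zero    x f = ≈-refl
  sumTo-*ˡ (suc n) x f = trans (+-congʳ (sumTo-*ˡ n x f)) (sym (distribˡ _ _ _))

  sumTo-zero : ∀ n (f : ℕ → Carrier) → (∀ k → f k ≈ 0#) → sumTo n f ≈ 0#
  sumTo-zero zero    f f≈0 = f≈0 0
  sumTo-zero (suc n) f f≈0 = trans (+-cong (sumTo-zero n f f≈0) (f≈0 (suc n))) (+-identityˡ _)

  sumTo-truncate : ∀ {n} r (f : ℕ → Carrier) → n ≤ r → (∀ k → n < k → f k ≈ 0#) →
                   sumTo r f ≈ sumTo n f
  sumTo-truncate zero    f z≤n f≈0 = ≈-refl
  sumTo-truncate (suc r) f n≤1+r f≈0 with ℕP.m≤n⇒m<n∨m≡n n≤1+r
  ... | inj₂ refl      = ≈-refl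
  ... | inj₁ (s≤s n≤r) = begin
    sumTo r f + f (suc r) ≈⟨ +-cong (sumTo-truncate r f n≤r f≈0) (f≈0 (suc r) (s≤s n≤r)) ⟩
    _ + 0#                ≈⟨ +-identityʳ _ ⟩
    _                     ∎

  esym-++ : ∀ (A B : List Carrier) t →
            esym t (A ++ B) ≈ sumTo t (λ k → esym k A * esym (t ∸ k) B)
  esym-++ A       B zero    = sym (*-identityˡ _)
  esym-++ []      B (suc t) = begin
    esym (suc t) B             ≈⟨ sym (+-identityʳ _) ⟩
    esym (suc t) B + 0#        ≈⟨ +-cong (sym (*-identityˡ _)) (sym (sumTo-zero t _ (λ k → zeroˡ _))) ⟩
    1# * esym (suc t) B + sumTo t (λ k → 0# * esym (t ∸ k) B)
                               ≈⟨ sym (sumTo-head t _) ⟩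
    sumTo (suc t) (λ k → esym k [] * esym (suc t ∸ k) B) ∎
  esym-++ (x ∷ A) B (suc t) = begin
    x * esym t (A ++ B) + esym (suc t) (A ++ B)
      ≈⟨ +-cong (*-congˡ (esym-++ A B t)) (trans (esym-++ A B (suc t)) (sumTo-head t _)) ⟩
    x * sumTo t P + (1# * esym (suc t) B + sumTo t Q)
      ≈⟨ x∙yz≈y∙xz _ _ _ ⟩
    1# * esym (suc t) B + (x * sumTo t P + sumTo t Q)
      ≈⟨ +-congˡ (+-congʳ (sym (sumTo-*ˡ t x P))) ⟩
    1# * esym (suc t) B + (sumTo t (λ k → x * P k) + sumTo t Q)
      ≈⟨ +-congˡ (sym (sumTo-+ t _ Q)) ⟩
    1# * esym (suc t) B + sumTo t (λ k → x * P k + Q k)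
      ≈⟨ +-congˡ (sumTo-cong t (λ k _ → trans (+-congʳ (sym (*-assoc _ _ _))) (sym (distribʳ _ _ _)))) ⟩
    1# * esym (suc t) B + sumTo t (λ k → esym (suc k) (x ∷ A) * esym (t ∸ k) B)
      ≈⟨ sym (sumTo-head t _) ⟩
    sumTo (suc t) (λ k → esym k (x ∷ A) * esym (suc t ∸ k) B) ∎
    where
    -- the two halves of e_{k+1}(x ∷ A) = x e_k(A) + e_{k+1}(A), against e_{t-k}(B)
    P Q : ℕ → Carrier
    P k = esym k A * esym (t ∸ k) B
    Q k = esym (suc k) A * esym (t ∸ k) B

  esym-vanish : ∀ (xs : List Carrier) t → length xs < t → esym t xs ≈ 0#
  esym-vanish []       (suc t) _       = ≈-refl
  esym-vanish (x ∷ xs) (suc t) (s≤s p) = begin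
    x * esym t xs + esym (suc t) xs
      ≈⟨ +-cong (*-congˡ (esym-vanish xs t p)) (esym-vanish xs (suc t) (ℕP.m≤n⇒m≤1+n p)) ⟩
    x * 0# + 0# ≈⟨ +-identityʳ _ ⟩
    x * 0#      ≈⟨ zeroʳ _ ⟩
    0#          ∎

  -- hsymBelow i k L = h_{i-k}(L), with h of negative degree read as 0.
  hsymBelow : ℕ → ℕ → List Carrier → Carrier
  hsymBelow i       zero    L = hsym i L
  hsymBelow zero    (suc k) L = 0#
  hsymBelow (suc i) (suc k) L = hsymBelow i k L

  hsymBelow-≤ : ∀ {i k} L → k ≤ i → hsymBelow i k L ≡ hsym (i ∸ k) L
  hsymBelow-≤ {i}     {zero}  L _       = refl
  hsymBelow-≤ {suc i} {suc k} L (s≤s p) = hsymBelow-≤ L p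

  hsymBelow-> : ∀ {i k} L → i < k → hsymBelow i k L ≡ 0#
  hsymBelow-> {zero}  {suc k} L _       = refl
  hsymBelow-> {suc i} {suc k} L (s≤s p) = hsymBelow-> L p

  windowTerm : (ℕ → Carrier) → (j m i k : ℕ) → Carrier
  windowTerm g j m i k =
    hsym k (applyUpTo g (suc (j ∸ k)))
      * hsymBelow i k (applyUpTo (λ t → g (j ∸ k ℕ.+ t)) (suc (m ℕ.+ k)))

  hsym-windows : ∀ j m (g : ℕ → Carrier) i →
                 hsym i (applyUpTo g (suc (j ℕ.+ m))) ≈ sumTo j (windowTerm g j m i)
  hsym-windows zero m g i rewrite ℕP.+-identityʳ m = sym (*-identityˡ _)
  hsym-windows (suc j) m g zero = begin
    1#                  ≈⟨ sym (*-identityˡ _) ⟩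
    1# * 1#             ≈⟨ sym (+-identityʳ _) ⟩
    1# * 1# + 0#        ≈⟨ +-congˡ (sym (sumTo-zero j _ (λ k → zeroʳ _))) ⟩
    _                   ≈⟨ sym (sumTo-head j _) ⟩
    sumTo (suc j) (windowTerm g (suc j) m zero) ∎
  hsym-windows (suc j) m g (suc i) = begin
    g 0 * hsym i (applyUpTo g (suc (suc (j ℕ.+ m)))) + hsym (suc i) (applyUpTo (g ∘ suc) (suc (j ℕ.+ m)))
      ≈⟨ +-cong (*-congˡ longerRun) (hsym-windows j m (g ∘ suc) (suc i)) ⟩
    g 0 * sumTo j A + sumTo j (windowTerm (g ∘ suc) j m (suc i))
      ≈⟨ +-congˡ (sym tail-sum) ⟩
    g 0 * sumTo j A + (G 0 + sumTo j (G ∘ suc))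
      ≈⟨ x∙yz≈y∙xz _ _ _ ⟩
    G 0 + (g 0 * sumTo j A + sumTo j (G ∘ suc))
      ≈⟨ +-congˡ (+-congʳ (sym (sumTo-*ˡ j (g 0) A))) ⟩
    G 0 + (sumTo j (λ k → g 0 * A k) + sumTo j (G ∘ suc))
      ≈⟨ +-congˡ (sym (sumTo-+ j _ _)) ⟩
    G 0 + sumTo j (λ k → g 0 * A k + G (suc k))
      ≈⟨ +-congˡ (sumTo-cong j (λ k _ → sym (term-split k))) ⟩
    G 0 + sumTo j (windowTerm g (suc j) m (suc i) ∘ suc)
      ≈⟨ sym (sumTo-head j _) ⟩
    sumTo (suc j) (windowTerm g (suc j) m (suc i)) ∎
    where
    A : ℕ → Carrier
    A = windowTerm g j (suc m) i
    -- the expansion of h_{i+1}(g_1..g_{j+m+1}), reindexed over 0..j+1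
    G : ℕ → Carrier
    G k = hsym k (applyUpTo (g ∘ suc) (suc j ∸ k))
            * hsymBelow (suc i) k (applyUpTo (λ t → g (suc j ∸ k ℕ.+ t)) (suc (m ℕ.+ k)))

    longerRun : hsym i (applyUpTo g (suc (suc (j ℕ.+ m)))) ≈ sumTo j A
    longerRun = ≡.subst (λ n → hsym i (applyUpTo g (suc n)) ≈ sumTo j A)
                        (ℕP.+-suc j m) (hsym-windows j (suc m) g i)

    -- h_{k+1}(g_0 ∷ L) = g_0 h_k(g_0 ∷ L) + h_{k+1}(L), multiplied out
    term-split : ∀ k → windowTerm g (suc j) m (suc i) (suc k) ≈ g 0 * A k + G (suc k)
    term-split k rewrite ℕP.+-suc m k = trans (distribʳ _ _ _) (+-congʳ (*-assoc _ _ _))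

    tail-sum : G 0 + sumTo j (G ∘ suc) ≈ sumTo j (windowTerm (g ∘ suc) j m (suc i))
    tail-sum = begin
      G 0 + sumTo j (G ∘ suc) ≈⟨ sym (sumTo-head j G) ⟩
      sumTo j G + G (suc j)   ≈⟨ +-cong (sumTo-cong j G≈term) last-vanishes ⟩
      _ + 0#                  ≈⟨ +-identityʳ _ ⟩
      _                       ∎
      where
      G≈term : ∀ k → k ≤ j → G k ≈ windowTerm (g ∘ suc) j m (suc i) k
      G≈term k k≤j rewrite ℕP.+-∸-assoc 1 k≤j = ≈-refl
      last-vanishes : G (suc j) ≈ 0#
      last-vanishes rewrite ℕP.n∸n≡0 j = zeroˡ _

module StirlingProducts {c ℓ : Level} (R : CommutativeRing c ℓ)
                        (v w : ℤ → CommutativeRing.Carrier R) where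
  open CommutativeRing R hiding (zero) renaming (refl to ≈-refl)
  open VStirling R
  open SymmetricFunctions R
  open import Relation.Binary.Reasoning.Setoid setoid

  diag : ℤ → ℤ → ℕ → Carrier
  diag c b t = v (c ℤ.- + t) * w (b ℤ.+ + t)

  run : ℤ → ℤ → ℕ → List Carrier
  run c b n = applyUpTo (diag c b) n

  diag-shift : ∀ c b d n → applyUpTo (λ t → diag c b (d ℕ.+ t)) n
                         ≡ run (c ℤ.- + d) (b ℤ.+ + d) n
  diag-shift c b d n = applyUpTo-cong n shift
    where
    sub-+ : ∀ x D T → x ℤ.- (D ℤ.+ T) ≡ x ℤ.- D ℤ.- T
    sub-+ = solve-∀
    add-+ : ∀ x D T → x ℤ.+ (D ℤ.+ T) ≡ x ℤ.+ D ℤ.+ T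
    add-+ = solve-∀
    shift : ∀ t → diag c b (d ℕ.+ t) ≡ diag (c ℤ.- + d) (b ℤ.+ + d) t
    shift t rewrite ℤP.pos-+ d t =
      cong₂ (λ x y → v x * w y) (sub-+ c (+ d) (+ t)) (add-+ b (+ d) (+ t))

  cV-esym : ∀ a b n k → k ≤ n →
            cV v w a b (+ n) (+ k) ≡ esym (n ∸ k) (run (a ℤ.+ + n ℤ.- + 1) b n)
  cV-esym a b n k k≤n rewrite ≤ᵇ-true k≤n = cong (esym (n ∸ k)) (map-upTo _ n)

  cV-vanish : ∀ a b n k → n < k → cV v w a b (+ n) (+ k) ≡ 0#
  cV-vanish a b n k n<k rewrite ≤ᵇ-false n<k = refl

  SV-hsym : ∀ a b n k → k ≤ n →
            SV v w a b (+ n) (+ k) ≡ hsym (n ∸ k) (run (a ℤ.+ + k) b (suc k))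
  SV-hsym a b n k k≤n rewrite ≤ᵇ-true k≤n = cong (hsym (n ∸ k)) (map-upTo _ (suc k))

  SV-vanish : ∀ a b n k → n < k → SV v w a b (+ n) (+ k) ≡ 0#
  SV-vanish a b n k n<k rewrite ≤ᵇ-false n<k = refl

  cV-shifted : ∀ a b s {i k} → k ≤ i →
               cV v w a b (+ (s ℕ.+ i)) (+ (s ℕ.+ k))
                 ≡ esym (i ∸ k) (run (a ℤ.+ + (s ℕ.+ i) ℤ.- + 1) b (s ℕ.+ i))
  cV-shifted a b s {i} {k} k≤i =
    ≡.trans (cV-esym a b (s ℕ.+ i) (s ℕ.+ k) (ℕP.+-monoʳ-≤ s k≤i))
            (cong₂ esym (ℕP.[m+n]∸[m+o]≡n∸o s i k) refl)

  SV-shifted : ∀ a b s i k →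
               SV v w a b (+ (s ℕ.+ i)) (+ (s ℕ.+ k))
                 ≡ hsymBelow i k (run (a ℤ.+ + (s ℕ.+ k)) b (suc (s ℕ.+ k)))
  SV-shifted a b s i k with k ℕ.≤? i
  ... | yes k≤i = ≡.trans (SV-hsym a b (s ℕ.+ i) (s ℕ.+ k) (ℕP.+-monoʳ-≤ s k≤i))
                    (≡.trans (cong₂ hsym (ℕP.[m+n]∸[m+o]≡n∸o s i k) refl)
                             (≡.sym (hsymBelow-≤ _ k≤i)))
  ... | no k≰i  = ≡.trans (SV-vanish a b (s ℕ.+ i) (s ℕ.+ k)
                                      (ℕP.+-monoʳ-< s (ℕP.≰⇒> k≰i)))
                          (≡.sym (hsymBelow-> _ (ℕP.≰⇒> k≰i)))

  -- Row j, column j - k: the degree is k (with e_k of j variables vanishing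
  -- for k > j, and SV vanishing through the negative column).
  cV-complement : ∀ a b j k →
                  cV v w a b (+ j) (+ j ℤ.- + k) ≈ esym k (run (a ℤ.+ + j ℤ.- + 1) b j)
  cV-complement a b j k with k ℕ.≤? j
  ... | yes k≤j rewrite minus-pos k≤j =
    reflexive (≡.trans (cV-esym a b j (j ∸ k) (ℕP.m∸n≤m j k))
                       (cong₂ esym (ℕP.m∸[m∸n]≡n k≤j) refl))
  ... | no k≰j rewrite proj₂ (minus-neg (ℕP.≰⇒> k≰j)) =
    sym (esym-vanish _ k (≡.subst (_< k) (≡.sym (length-applyUpTo _ j)) (ℕP.≰⇒> k≰j)))

  SV-complement : ∀ a b {j k} → k ≤ j →
                  SV v w a b (+ j) (+ j ℤ.- + k)
                    ≡ hsym k (run (a ℤ.+ + (j ∸ k)) b (suc (j ∸ k)))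
  SV-complement a b {j} {k} k≤j rewrite minus-pos k≤j =
    ≡.trans (SV-hsym a b j (j ∸ k) (ℕP.m∸n≤m j k))
            (cong₂ hsym (ℕP.m∸[m∸n]≡n k≤j) refl)

  SV-complement-vanish : ∀ a b {j k} → j < k → SV v w a b (+ j) (+ j ℤ.- + k) ≡ 0#
  SV-complement-vanish a b j<k rewrite proj₂ (minus-neg j<k) = refl

  cTerm : (α β : ℤ) (s i j k : ℕ) → Carrier
  cTerm α β s i j k = cV v w (α ℤ.- + i) β (+ (s ℕ.+ i)) (+ (s ℕ.+ k))
                      * cV v w (α ℤ.+ + s) (β ℤ.- + j) (+ j) (+ j ℤ.- + k)

  STerm : (α β : ℤ) (s i j k : ℕ) → Carrier
  STerm α β s i j k = SV v w α (β ℤ.- + k) (+ (s ℕ.+ i)) (+ (s ℕ.+ k))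
                      * SV v w (α ℤ.+ + s ℤ.+ + k) (β ℤ.- + j) (+ j) (+ j ℤ.- + k)

  -- Outside the triangular range the terms vanish: the first c-factor for
  -- k > i (column above row), the second S-factor for k > j (negative column).
  cTerm-beyond : ∀ α β s i j k → i < k → cTerm α β s i j k ≈ 0#
  cTerm-beyond α β s i j k i<k =
    trans (*-congʳ (reflexive (cV-vanish (α ℤ.- + i) β (s ℕ.+ i) (s ℕ.+ k) (ℕP.+-monoʳ-< s i<k))))
          (zeroˡ _)

  STerm-beyond : ∀ α β s i j k → j < k → STerm α β s i j k ≈ 0#
  STerm-beyond α β s i j k j<k =
    trans (*-congˡ (reflexive (SV-complement-vanish _ _ j<k))) (zeroʳ _)

  gap : ∀ s i j → s ℕ.+ i ℕ.+ j ∸ (s ℕ.+ j) ≡ i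
  gap s i j = ≡.trans (cong (_∸ (s ℕ.+ j)) (ℕ-+-right-comm s i j)) (ℕP.m+n∸m≡n (s ℕ.+ j) i)

  column≤row : ∀ s i j → s ℕ.+ j ≤ s ℕ.+ i ℕ.+ j
  column≤row s i j = ℕP.+-monoˡ-≤ j (ℕP.m≤m+n s i)

  -- The c-identity: the run of length s+i+j splits into the run of the second
  -- factor (length j) followed by the run of the first factor (length s+i).
  cV-product : ∀ α β s i j →
               cV v w (α ℤ.- + i) (β ℤ.- + j) (+ (s ℕ.+ i ℕ.+ j)) (+ (s ℕ.+ j))
                 ≈ sumTo i (cTerm α β s i j)
  cV-product α β s i j = begin
    cV v w (α ℤ.- + i) (β ℤ.- + j) (+ (s ℕ.+ i ℕ.+ j)) (+ (s ℕ.+ j))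
      ≡⟨ cV-esym (α ℤ.- + i) (β ℤ.- + j) (s ℕ.+ i ℕ.+ j) (s ℕ.+ j) (column≤row s i j) ⟩
    esym (s ℕ.+ i ℕ.+ j ∸ (s ℕ.+ j)) (run C (β ℤ.- + j) (s ℕ.+ i ℕ.+ j))
      ≡⟨ cong₂ esym (gap s i j) split ⟩
    esym i (front ++ back)
      ≈⟨ esym-++ front back i ⟩
    sumTo i (λ k → esym k front * esym (i ∸ k) back)
      ≈⟨ sumTo-cong i (λ k k≤i → trans (*-comm _ _)
           (sym (*-cong (reflexive (cV-shifted (α ℤ.- + i) β s k≤i))
                        (cV-complement (α ℤ.+ + s) (β ℤ.- + j) j k)))) ⟩
    sumTo i (cTerm α β s i j) ∎
    where
    C : ℤ
    C = α ℤ.- + i ℤ.+ + (s ℕ.+ i ℕ.+ j) ℤ.- + 1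
    front back : List Carrier
    front = run (α ℤ.+ + s ℤ.+ + j ℤ.- + 1) (β ℤ.- + j) j
    back  = run (α ℤ.- + i ℤ.+ + (s ℕ.+ i) ℤ.- + 1) β (s ℕ.+ i)

    front-start : C ≡ α ℤ.+ + s ℤ.+ + j ℤ.- + 1
    front-start rewrite ℤP.pos-+ (s ℕ.+ i) j | ℤP.pos-+ s i = identity α (+ s) (+ i) (+ j)
      where
      identity : ∀ a S I J → a ℤ.- I ℤ.+ (S ℤ.+ I ℤ.+ J) ℤ.- + 1 ≡ a ℤ.+ S ℤ.+ J ℤ.- + 1
      identity = solve-∀
    back-start : C ℤ.- + j ≡ α ℤ.- + i ℤ.+ + (s ℕ.+ i) ℤ.- + 1
    back-start rewrite ℤP.pos-+ (s ℕ.+ i) j = identity (α ℤ.- + i) (+ (s ℕ.+ i)) (+ j)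
      where
      identity : ∀ a X J → a ℤ.+ (X ℤ.+ J) ℤ.- + 1 ℤ.- J ≡ a ℤ.+ X ℤ.- + 1
      identity = solve-∀
    back-weight : β ℤ.- + j ℤ.+ + j ≡ β
    back-weight = identity β (+ j)
      where
      identity : ∀ b J → b ℤ.- J ℤ.+ J ≡ b
      identity = solve-∀

    split : run C (β ℤ.- + j) (s ℕ.+ i ℕ.+ j) ≡ front ++ back
    split = ≡.trans (cong (run C (β ℤ.- + j)) (ℕP.+-comm (s ℕ.+ i) j))
      (≡.trans (applyUpTo-++ _ j (s ℕ.+ i))
        (cong₂ _++_ (cong (λ c′ → run c′ (β ℤ.- + j) j) front-start)
                    (≡.trans (diag-shift C (β ℤ.- + j) j (s ℕ.+ i))
                             (cong₂ (λ c′ b′ → run c′ b′ (s ℕ.+ i)) back-start back-weight))))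

  -- The S-identity: the overlapping-window rule for the run g of the left-hand
  -- side; window k is the run of the first factor, the prefix that of the second.
  SV-product : ∀ α β s i j →
               SV v w α (β ℤ.- + j) (+ (s ℕ.+ i ℕ.+ j)) (+ (s ℕ.+ j))
                 ≈ sumTo j (STerm α β s i j)
  SV-product α β s i j = begin
    SV v w α (β ℤ.- + j) (+ (s ℕ.+ i ℕ.+ j)) (+ (s ℕ.+ j))
      ≡⟨ SV-hsym α (β ℤ.- + j) (s ℕ.+ i ℕ.+ j) (s ℕ.+ j) (column≤row s i j) ⟩
    hsym (s ℕ.+ i ℕ.+ j ∸ (s ℕ.+ j)) (applyUpTo g (suc (s ℕ.+ j)))
      ≡⟨ cong₂ (λ t n → hsym t (applyUpTo g (suc n))) (gap s i j) (ℕP.+-comm s j) ⟩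
    hsym i (applyUpTo g (suc (j ℕ.+ s)))
      ≈⟨ hsym-windows j s g i ⟩
    sumTo j (windowTerm g j s i)
      ≈⟨ sumTo-cong j (λ k k≤j → trans (*-comm _ _)
           (reflexive (cong₂ _*_ (window≡first k≤j) (prefix≡second k≤j)))) ⟩
    sumTo j (STerm α β s i j) ∎
    where
    g : ℕ → Carrier
    g = diag (α ℤ.+ + (s ℕ.+ j)) (β ℤ.- + j)

    window≡first : ∀ {k} → k ≤ j →
                   hsymBelow i k (applyUpTo (λ t → g (j ∸ k ℕ.+ t)) (suc (s ℕ.+ k)))
                     ≡ SV v w α (β ℤ.- + k) (+ (s ℕ.+ i)) (+ (s ℕ.+ k))
    window≡first {k} k≤j = ≡.trans
      (cong (hsymBelow i k)
        (≡.trans (diag-shift (α ℤ.+ + (s ℕ.+ j)) (β ℤ.- + j) (j ∸ k) (suc (s ℕ.+ k)))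
                 (cong₂ (λ c′ b′ → run c′ b′ (suc (s ℕ.+ k))) offset-start weight)))
      (≡.sym (SV-shifted α (β ℤ.- + k) s i k))
      where
      offset-start : α ℤ.+ + (s ℕ.+ j) ℤ.- + (j ∸ k) ≡ α ℤ.+ + (s ℕ.+ k)
      offset-start rewrite ≡.sym (minus-pos k≤j) | ℤP.pos-+ s j | ℤP.pos-+ s k =
        identity α (+ s) (+ j) (+ k)
        where
        identity : ∀ a S J K → a ℤ.+ (S ℤ.+ J) ℤ.- (J ℤ.- K) ≡ a ℤ.+ (S ℤ.+ K)
        identity = solve-∀
      weight : β ℤ.- + j ℤ.+ + (j ∸ k) ≡ β ℤ.- + k
      weight rewrite ≡.sym (minus-pos k≤j) = identity β (+ j) (+ k)
        where
        identity : ∀ b J K → b ℤ.- J ℤ.+ (J ℤ.- K) ≡ b ℤ.- K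
        identity = solve-∀

    prefix≡second : ∀ {k} → k ≤ j →
                    hsym k (applyUpTo g (suc (j ∸ k)))
                      ≡ SV v w (α ℤ.+ + s ℤ.+ + k) (β ℤ.- + j) (+ j) (+ j ℤ.- + k)
    prefix≡second {k} k≤j = ≡.sym (≡.trans (SV-complement _ _ k≤j)
      (cong (λ c′ → hsym k (run c′ (β ℤ.- + j) (suc (j ∸ k)))) prefix-start))
      where
      prefix-start : α ℤ.+ + s ℤ.+ + k ℤ.+ + (j ∸ k) ≡ α ℤ.+ + (s ℕ.+ j)
      prefix-start rewrite ≡.sym (minus-pos k≤j) | ℤP.pos-+ s j = identity α (+ s) (+ j) (+ k)
        where
        identity : ∀ a S J K → a ℤ.+ S ℤ.+ K ℤ.+ (J ℤ.- K) ≡ a ℤ.+ (S ℤ.+ J)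
        identity = solve-∀

theorem6p2 : {c ℓ : Level} (R : CommutativeRing c ℓ) →
    let open CommutativeRing R
        open VStirling R
    in (v w : ℤ → Carrier) (α β : ℤ) (s r : ℕ) (i j : ℕ) → i ≤ r → j ≤ r →
      (cV v w (α ℤ.- + i) (β ℤ.- + j) (+ (s Data.Nat.+ i Data.Nat.+ j)) (+ (s Data.Nat.+ j))
        ≈ sumTo r (λ k → cV v w (α ℤ.- + i) β (+ (s Data.Nat.+ i)) (+ (s Data.Nat.+ k))
                        * cV v w (α ℤ.+ + s) (β ℤ.- + j) (+ j) (+ j ℤ.- + k)))
      ×
      (SV v w α (β ℤ.- + j) (+ (s Data.Nat.+ i Data.Nat.+ j)) (+ (s Data.Nat.+ j))
        ≈ sumTo r (λ k → SV v w α (β ℤ.- + k) (+ (s Data.Nat.+ i)) (+ (s Data.Nat.+ k))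
                        * SV v w (α ℤ.+ + s ℤ.+ + k) (β ℤ.- + j) (+ j) (+ j ℤ.- + k)))
theorem6p2 R v w α β s r i j i≤r j≤r =
    trans (cV-product α β s i j) (sym (sumTo-truncate r _ i≤r (cTerm-beyond α β s i j)))
  , trans (SV-product α β s i j) (sym (sumTo-truncate r _ j≤r (STerm-beyond α β s i j)))
  where
  open CommutativeRing R using (trans; sym)
  open SymmetricFunctions R using (sumTo-truncate)
  open StirlingProducts R v w
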